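{- For $n=3$ and $n=4$, $\mathrm{bet}(n)=n$.
   Context: An ordering of $[n]$ is a bijection $\phi:[n]\to[n]$. A ternary constraint is a triple $(x_1,x_2,x_3)$ of distinct elements of $[n]$. $\phi$ between-satisfies the constraint if $\phi(x_1)<\phi(x_2)<\phi(x_3)$ or $\phi(x_3)<\phi(x_2)<\phi(x_1)$. $\mathrm{bet}(n)$ is the minimum size of a set of orderings of $[n]$ such that every ternary constraint is between-satisfied by some ordering in the set. -}

module Defs where

open import Data.Nat using (ℕ; _<_)
open import Data.Fin using (Fin; _<_)
open import Data.Fin.Permutation using (Permutation′; _⟨$⟩ʳ_)
open import Data.Product using (Σ; _×_; ∃)
open import Data.Sum using (_⊎_)
open import Relation.Binary.PropositionalEquality using (_≢_)
open import Relation.Nullary using (¬_)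

Ordering : ℕ → Set
Ordering n = Permutation′ n

record Constraint (n : ℕ) : Set where
  constructor constraint
  field
    x₁ x₂ x₃ : Fin n
    x₁≢x₂ : x₁ ≢ x₂
    x₁≢x₃ : x₁ ≢ x₃
    x₂≢x₃ : x₂ ≢ x₃

BetweenSat : ∀ {n} → Ordering n → Constraint n → Set
BetweenSat φ (constraint x₁ x₂ x₃ _ _ _) =
  ((φ ⟨$⟩ʳ x₁) Data.Fin.< (φ ⟨$⟩ʳ x₂) × (φ ⟨$⟩ʳ x₂) Data.Fin.< (φ ⟨$⟩ʳ x₃))
  ⊎ ((φ ⟨$⟩ʳ x₃) Data.Fin.< (φ ⟨$⟩ʳ x₂) × (φ ⟨$⟩ʳ x₂) Data.Fin.< (φ ⟨$⟩ʳ x₁))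

Covers : ∀ {n k} → (Fin k → Ordering n) → Set
Covers {n} {k} fam = (c : Constraint n) → ∃ λ (i : Fin k) → BetweenSat (fam i) c

-- bet(n) = m : m is the minimum size of a covering set of orderings.
-- (A set of size k is represented as a family indexed by Fin k; repetitions
-- only make a family larger, so the minimum is unaffected.)
BetIs : ℕ → ℕ → Set
BetIs n m =
  (Σ (Fin m → Ordering n) Covers)
  × (∀ (k : ℕ) → k Data.Nat.< m → (fam : Fin k → Ordering n) → ¬ Covers fam)

module Submission where

-- Upper bounds: explicit families of 3 resp. 4 orderings, built from
-- transpositions, are checked to cover all constraints by a decision
-- procedure that runs over all triples of points.
--
-- Lower bounds rest on one observation about three distinct points: at most
-- one of them lies between the other two.  Hence the three constraints on a
-- point set {x,y,z} (one for each choice of middle point) are pairwise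
-- exclusive, and k pairwise exclusive constraints need k distinct orderings
-- (pigeonhole).  This gives bet(n) ≥ 3 whenever n ≥ 3.  If moreover k
-- exclusive constraints are covered by only k orderings, each of them is
-- satisfied by exactly one ordering of the family.  For n ≥ 4 and three
-- orderings, consider the three constraints "0 between u and v" for
-- {u,v} ⊆ {1,2,3}: each is satisfied by a unique ordering, an ordering
-- satisfying one of them satisfies a second one, but none satisfies all
-- three.  A short combinatorial lemma shows that this is impossible, so
-- bet(n) ≥ 4 whenever n ≥ 4.

open import Defs

open import Data.Nat using (ℕ; _+_; _≤_)
open import Data.Nat.Properties using (m≤n⇒m<n∨m≡n; <⇒≱; 1+n≰n)
open import Data.Fin using (Fin; zero; suc)
open import Data.Fin.Patterns using (0F; 1F; 2F; 3F)
open import Data.Fin.Properties using (_≟_; all?; any?; injective⇒≤; <-strictTotalOrder)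
open import Data.Fin.Permutation using (_⟨$⟩ʳ_; id; transpose; _∘ₚ_)
open import Data.Vec.Functional using ([]; _∷_)
open import Data.Product using (_×_; _,_; proj₁; proj₂; ∃)
open import Data.Sum using (_⊎_; inj₁; inj₂) renaming (map to ⊎-map; map₂ to ⊎-map₂)
open import Data.Empty using (⊥; ⊥-elim)
open import Function using (_∘_; Injection; Injective)
open import Function.Properties.Inverse using (↔⇒↣)
open import Relation.Binary using (StrictTotalOrder; tri<; tri≈; tri>)
open import Relation.Binary.PropositionalEquality using (_≡_; _≢_; refl; sym; trans; cong; subst; ≢-sym)
open import Relation.Nullary using (¬_; Dec; yes; no)
open import Relation.Nullary.Decidable using (toWitness; _×-dec_; _⊎-dec_)

module Betweenness {a ℓ₁ ℓ₂} (O : StrictTotalOrder a ℓ₁ ℓ₂) where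
  open StrictTotalOrder O using (_≈_; _<_; _<?_; asym; compare) renaming (Carrier to A; trans to <-trans)

  Between : A → A → A → Set ℓ₂
  Between a b c = (a < b × b < c) ⊎ (c < b × b < a)

  between? : ∀ a b c → Dec (Between a b c)
  between? a b c = ((a <? b) ×-dec (b <? c)) ⊎-dec ((c <? b) ×-dec (b <? a))

  between-flip : ∀ {a b c} → Between a b c → Between c b a
  between-flip (inj₁ (a<b , b<c)) = inj₂ (a<b , b<c)
  between-flip (inj₂ (c<b , b<a)) = inj₁ (c<b , b<a)

  between-unique-middle : ∀ {a b c} → Between a b c → Between a c b → ⊥
  between-unique-middle (inj₁ (a<b , b<c)) (inj₁ (_ , c<b))   = asym b<c c<b
  between-unique-middle (inj₁ (a<b , b<c)) (inj₂ (_ , c<a))   = asym a<b (<-trans b<c c<a)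
  between-unique-middle (inj₂ (c<b , b<a)) (inj₁ (a<c , _))   = asym c<b (<-trans b<a a<c)
  between-unique-middle (inj₂ (c<b , b<a)) (inj₂ (b<c , _))   = asym c<b b<c

  between-split : ∀ {a b c d} → Between a b c → ¬ d ≈ b → Between a b d ⊎ Between c b d
  between-split {b = b} {d = d} bet d≉b with compare d b
  between-split (inj₁ (a<b , b<c)) _ | tri< d<b _ _ = inj₂ (inj₂ (d<b , b<c))
  between-split (inj₂ (c<b , b<a)) _ | tri< d<b _ _ = inj₁ (inj₂ (d<b , b<a))
  between-split _ d≉b                | tri≈ _ d≈b _ = ⊥-elim (d≉b d≈b)
  between-split (inj₁ (a<b , b<c)) _ | tri> _ _ b<d = inj₁ (inj₁ (a<b , b<d))
  between-split (inj₂ (c<b , b<a)) _ | tri> _ _ b<d = inj₂ (inj₁ (c<b , b<d))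

  between-not-all-pairs : ∀ {a b c d} → Between a b c → Between a b d → Between c b d → ⊥
  between-not-all-pairs (inj₁ (a<b , b<c)) (inj₁ _)          (inj₁ (c<b , _)) = asym b<c c<b
  between-not-all-pairs (inj₁ _)          (inj₁ (_ , b<d)) (inj₂ (d<b , _)) = asym b<d d<b
  between-not-all-pairs (inj₁ (a<b , _))  (inj₂ (_ , b<a)) _                = asym a<b b<a
  between-not-all-pairs (inj₂ (_ , b<a))  (inj₁ (a<b , _)) _                = asym a<b b<a
  between-not-all-pairs (inj₂ _)          (inj₂ (d<b , _)) (inj₁ (_ , b<d)) = asym b<d d<b
  between-not-all-pairs (inj₂ (c<b , _))  (inj₂ _)          (inj₂ (_ , b<c)) = asym c<b b<c

-- Positions are points of Fin n; BetweenSat φ (x,y,z) is, by definition,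
-- Between (φ x) (φ y) (φ z).
open module FinBetweenness {n} = Betweenness (<-strictTotalOrder n)

separated : ∀ {n} (φ : Ordering n) {x y : Fin n} → x ≢ y → φ ⟨$⟩ʳ x ≢ φ ⟨$⟩ʳ y
separated φ x≢y = x≢y ∘ Injection.injective (↔⇒↣ φ)

-- Building coverings: every triple either repeats a point or is
-- between-satisfied by some ordering of the family.  This is decidable, so
-- concrete coverings can be verified by evaluation.
module _ {n k : ℕ} (fam : Fin k → Ordering n) where

  TripleCovered : Fin n → Fin n → Fin n → Set
  TripleCovered x y z =
    x ≡ y ⊎ x ≡ z ⊎ y ≡ z ⊎ ∃ λ i → Between (fam i ⟨$⟩ʳ x) (fam i ⟨$⟩ʳ y) (fam i ⟨$⟩ʳ z)

  tripleCovered? : ∀ x y z → Dec (TripleCovered x y z)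
  tripleCovered? x y z =
    (x ≟ y) ⊎-dec (x ≟ z) ⊎-dec (y ≟ z)
      ⊎-dec any? (λ i → between? (fam i ⟨$⟩ʳ x) (fam i ⟨$⟩ʳ y) (fam i ⟨$⟩ʳ z))

  allTriplesCovered? : Dec (∀ x y z → TripleCovered x y z)
  allTriplesCovered? = all? λ x → all? λ y → all? λ z → tripleCovered? x y z

  covers-from-triples : (∀ x y z → TripleCovered x y z) → Covers fam
  covers-from-triples all (constraint x y z x≢y x≢z y≢z) with all x y z
  ... | inj₁ x≡y                    = ⊥-elim (x≢y x≡y)
  ... | inj₂ (inj₁ x≡z)             = ⊥-elim (x≢z x≡z)
  ... | inj₂ (inj₂ (inj₁ y≡z))      = ⊥-elim (y≢z y≡z)
  ... | inj₂ (inj₂ (inj₂ covering)) = covering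

-- The three constraints on the point set of c, one for each choice of the
-- middle point (index 1 is c itself).
middles : ∀ {n} → Constraint n → Fin 3 → Constraint n
middles (constraint x y z x≢y x≢z y≢z) 0F = constraint y x z (≢-sym x≢y) y≢z x≢z
middles (constraint x y z x≢y x≢z y≢z) 1F = constraint x y z x≢y x≢z y≢z
middles (constraint x y z x≢y x≢z y≢z) 2F = constraint x z y x≢z x≢y (≢-sym y≢z)

Exclusive : ∀ {n m} → (Fin m → Constraint n) → Set
Exclusive {n} cs = ∀ (φ : Ordering n) {s t} → BetweenSat φ (cs s) → BetweenSat φ (cs t) → s ≡ t

-- The middles of a constraint are exclusive, since at most one of three
-- points lies between the other two.
middles-exclusive : ∀ {n} (c : Constraint n) → Exclusive (middles c)
middles-exclusive (constraint _ _ _ _ _ _) _ {0F} {0F} _ _   = refl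
middles-exclusive (constraint _ _ _ _ _ _) _ {1F} {1F} _ _   = refl
middles-exclusive (constraint _ _ _ _ _ _) _ {2F} {2F} _ _   = refl
middles-exclusive (constraint _ _ _ _ _ _) _ {0F} {1F} b₀ b₁ =
  ⊥-elim (between-unique-middle (between-flip b₀) (between-flip b₁))
middles-exclusive (constraint _ _ _ _ _ _) _ {1F} {0F} b₁ b₀ =
  ⊥-elim (between-unique-middle (between-flip b₀) (between-flip b₁))
middles-exclusive (constraint _ _ _ _ _ _) _ {0F} {2F} b₀ b₂ =
  ⊥-elim (between-unique-middle b₀ (between-flip b₂))
middles-exclusive (constraint _ _ _ _ _ _) _ {2F} {0F} b₂ b₀ =
  ⊥-elim (between-unique-middle b₀ (between-flip b₂))
middles-exclusive (constraint _ _ _ _ _ _) _ {1F} {2F} b₁ b₂ =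
  ⊥-elim (between-unique-middle b₁ b₂)
middles-exclusive (constraint _ _ _ _ _ _) _ {2F} {1F} b₂ b₁ =
  ⊥-elim (between-unique-middle b₁ b₂)

∷-injective : ∀ {k m} {x : Fin k} {w : Fin m → Fin k} →
              Injective _≡_ _≡_ w → (∀ s → x ≢ w s) → Injective _≡_ _≡_ (x ∷ w)
∷-injective w-inj x∉w {zero}  {zero}  _ = refl
∷-injective w-inj x∉w {zero}  {suc t} e = ⊥-elim (x∉w t e)
∷-injective w-inj x∉w {suc s} {zero}  e = ⊥-elim (x∉w s (sym e))
∷-injective w-inj x∉w {suc s} {suc t} e = cong suc (w-inj e)

module Covering {n k : ℕ} (fam : Fin k → Ordering n) (cov : Covers fam) where

  coverer : Constraint n → Fin k
  coverer c = proj₁ (cov c)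

  satisfied-at : ∀ {c i} → i ≡ coverer c → BetweenSat (fam i) c
  satisfied-at {c} i≡ = subst (λ j → BetweenSat (fam j) c) (sym i≡) (proj₂ (cov c))

  coverer-injective : ∀ {m} (cs : Fin m → Constraint n) → Exclusive cs →
                      Injective _≡_ _≡_ (coverer ∘ cs)
  coverer-injective cs ex {s} e = ex (fam (coverer (cs s))) (satisfied-at refl) (satisfied-at e)

  exclusive-lower-bound : ∀ {m} (cs : Fin m → Constraint n) → Exclusive cs → m ≤ k
  exclusive-lower-bound cs ex = injective⇒≤ (coverer-injective cs ex)

  -- With exactly k exclusive constraints, every ordering satisfying one of
  -- them is the one chosen for it: otherwise k + 1 distinct orderings exist.
  covered-once : ∀ (cs : Fin k → Constraint n) → Exclusive cs →
                 ∀ {i t} → BetweenSat (fam i) (cs t) → i ≡ coverer (cs t)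
  covered-once cs ex {i} {t} sat with i ≟ coverer (cs t)
  ... | yes i≡ = i≡
  ... | no  i≢ = ⊥-elim (1+n≰n (injective⇒≤ (∷-injective (coverer-injective cs ex) outside)))
    where
    outside : ∀ s → i ≢ coverer (cs s)
    outside s i≡ with ex (fam i) sat (satisfied-at i≡)
    ... | refl = i≢ i≡

-- With at least three points, at least three orderings are needed: the
-- middles of the constraint (0,1,2) are exclusive.
three-needed : ∀ {m k} (fam : Fin k → Ordering (3 + m)) → Covers fam → 3 ≤ k
three-needed {m} fam cov =
  Covering.exclusive-lower-bound fam cov (middles c₀₁₂) (middles-exclusive c₀₁₂)
  where
  c₀₁₂ : Constraint (3 + m)
  c₀₁₂ = constraint 0F 1F 2F (λ ()) (λ ()) (λ ())

-- Three properties of indices, each held by exactly one index, such that an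
-- index holding one of them holds another one but none holds all three,
-- cannot exist: every index holds none or two of the properties, while each
-- property is held exactly once.
three-properties :
  ∀ {I : Set} (P Q R : I → Set) →
  (∀ {i j} → P i → P j → i ≡ j) → (∀ {i j} → Q i → Q j → i ≡ j) → (∀ {i j} → R i → R j → i ≡ j) →
  (∀ {i} → P i → Q i ⊎ R i) → (∀ {i} → Q i → P i ⊎ R i) → (∀ {i} → R i → P i ⊎ Q i) →
  (∀ {i} → P i → Q i → R i → ⊥) → ∃ P → ∃ Q → ∃ R → ⊥
three-properties P Q R P! Q! R! P⇒ Q⇒ R⇒ none (_ , Pp) (_ , Qq) (_ , Rr) with P⇒ Pp
... | inj₁ Qp with R⇒ Rr
...   | inj₁ Pr = none Pp Qp (subst R (P! Pr Pp) Rr)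
...   | inj₂ Qr = none Pp Qp (subst R (Q! Qr Qp) Rr)
three-properties P Q R P! Q! R! P⇒ Q⇒ R⇒ none (_ , Pp) (_ , Qq) (_ , Rr)
    | inj₂ Rp with Q⇒ Qq
...   | inj₁ Pq = none Pp (subst Q (P! Pq Pp) Qq) Rp
...   | inj₂ Rq = none Pp (subst Q (R! Rq Rp) Qq) Rp

no-three-cover : ∀ {m} (fam : Fin 3 → Ordering (4 + m)) → ¬ Covers fam
no-three-cover {m} fam cov =
  three-properties P Q R (unique c₁₂) (unique c₁₃) (unique c₂₃) P⇒ Q⇒ R⇒
    between-not-all-pairs (cov c₁₂) (cov c₁₃) (cov c₂₃)
  where
  open Covering fam cov

  c₁₂ c₁₃ c₂₃ : Constraint (4 + m)
  c₁₂ = constraint 1F 0F 2F (λ ()) (λ ()) (λ ())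
  c₁₃ = constraint 1F 0F 3F (λ ()) (λ ()) (λ ())
  c₂₃ = constraint 2F 0F 3F (λ ()) (λ ()) (λ ())

  P Q R : Fin 3 → Set
  P i = BetweenSat (fam i) c₁₂
  Q i = BetweenSat (fam i) c₁₃
  R i = BetweenSat (fam i) c₂₃

  unique : ∀ c {i j} → BetweenSat (fam i) c → BetweenSat (fam j) c → i ≡ j
  unique c sᵢ sⱼ = trans (once sᵢ) (sym (once sⱼ))
    where
    once : ∀ {i} → BetweenSat (fam i) c → i ≡ coverer c
    once = covered-once (middles c) (middles-exclusive c) {t = 1F}

  P⇒ : ∀ {i} → P i → Q i ⊎ R i
  P⇒ {i} s = between-split s (separated (fam i) λ ())

  Q⇒ : ∀ {i} → Q i → P i ⊎ R i
  Q⇒ {i} s = ⊎-map₂ between-flip (between-split s (separated (fam i) λ ()))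

  R⇒ : ∀ {i} → R i → P i ⊎ Q i
  R⇒ {i} s = ⊎-map between-flip between-flip (between-split s (separated (fam i) λ ()))

four-needed : ∀ {m k} (fam : Fin k → Ordering (4 + m)) → Covers fam → 4 ≤ k
four-needed fam cov
  with m≤n⇒m<n∨m≡n (three-needed fam cov)
... | inj₁ 3<k = 3<k
... | inj₂ refl = ⊥-elim (no-three-cover fam cov)

bet-from : ∀ {n m} (fam : Fin m → Ordering n) → Covers fam →
           (∀ {k} (fam′ : Fin k → Ordering n) → Covers fam′ → m ≤ k) → BetIs n m
bet-from fam cov lower = (fam , cov) , λ k k<m fam′ cov′ → <⇒≱ k<m (lower fam′ cov′)

-- Optimal coverings.  An ordering maps each point to its position, so
-- transpose i j exchanges the positions of i and j.
orderings₃ : Fin 3 → Ordering 3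
orderings₃ = id ∷ transpose 0F 1F ∷ transpose 1F 2F ∷ []

orderings₄ : Fin 4 → Ordering 4
orderings₄ = id ∷ transpose 1F 3F ∷ (transpose 0F 1F ∘ₚ transpose 2F 3F) ∷ transpose 0F 2F ∷ []

orderings₃-cover : Covers orderings₃
orderings₃-cover = covers-from-triples orderings₃ (toWitness {a? = allTriplesCovered? orderings₃} _)

orderings₄-cover : Covers orderings₄
orderings₄-cover = covers-from-triples orderings₄ (toWitness {a? = allTriplesCovered? orderings₄} _)

lemmaA1 : BetIs 3 3 × BetIs 4 4
lemmaA1 =
  bet-from orderings₃ orderings₃-cover three-needed ,
  bet-from orderings₄ orderings₄-cover four-needed
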